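{- Let $\Gamma\neq\mathbb N$ be a telescopic numerical semigroup. Then $(\mathrm e(\Gamma)-2)\,2^{\mathrm e(\Gamma)}+2\le \mathrm c(\Gamma)$.
   Context: A numerical semigroup is a submonoid $\Gamma$ of $(\mathbb N,+)$ with finite complement in $\mathbb N$; $\mathrm F(\Gamma)$ is the largest integer not in $\Gamma$, $\mathrm c(\Gamma)=\mathrm F(\Gamma)+1$ is its conductor, and $\mathrm e(\Gamma)$ (embedding dimension) is the cardinality of its minimal generating set. $\langle X\rangle$ denotes the submonoid of $\mathbb N$ generated by $X$. For minimal generators listed in a fixed order $(r_0,\ldots,r_h)$, set $d_k=\gcd(r_0,\ldots,r_{k-1})$ for $k=1,\ldots,h+1$ and $\Gamma_k=\langle r_0/d_{k+1},\ldots,r_k/d_{k+1}\rangle$. Gluing: if $A$ is the minimal generating set of a numerical semigroup and $A=A_1\cup A_2$ is a nontrivial partition with $a_i=\gcd(A_i)$, then $A$ is the gluing of $A_1$ and $A_2$ if $\mathrm{lcm}(a_1,a_2)\in\langle A_1\rangle\cap\langle A_2\rangle$. $\Gamma$ is free for the arrangement $(r_0,\ldots,r_h)$ if either $h=0$ (so $r_0=1$) or $\{r_0,\ldots,r_h\}$ is the gluing of $\{r_0,\ldots,r_{h-1}\}$ and $\{r_h\}$ and $\Gamma_{h-1}$ is free for the arrangement $(r_0/d_h,\ldots,r_{h-1}/d_h)$. $\Gamma$ is telescopic if it is free for the arrangement of its minimal generators in increasing order. -}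

module Defs where

open import Data.Nat using (ℕ; zero; suc; _+_; _*_; _≤_; _<_; _/_)
open import Data.Nat.GCD using (gcd)
open import Data.Nat.LCM using (lcm)
open import Data.List using (List; []; _∷_; _∷ʳ_; foldr; map; length; removeAt)
open import Data.List.Membership.Propositional using (_∈_)
open import Data.Fin using (Fin)
open import Data.Product using (∃; _×_)
open import Relation.Nullary using (¬_)
open import Relation.Binary.PropositionalEquality using (_≢_)

data _∈⟨_⟩ : ℕ → List ℕ → Set where
  zero∈ : ∀ {X} → 0 ∈⟨ X ⟩
  add∈  : ∀ {X a n} → a ∈ X → n ∈⟨ X ⟩ → (a + n) ∈⟨ X ⟩

IsNumerical : List ℕ → Set
IsNumerical X = ∃ λ N → ∀ n → N ≤ n → n ∈⟨ X ⟩

IsMinimalGens : List ℕ → Set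
IsMinimalGens X = ∀ (i : Fin (length X)) → ¬ (Data.List.lookup X i ∈⟨ removeAt X i ⟩)

gcdList : List ℕ → ℕ
gcdList = foldr gcd 0

-- total division (only used with nonzero divisors)
divBy : ℕ → ℕ → ℕ
divBy x zero    = 0
divBy x (suc d) = x / suc d

data Free : List ℕ → Set where
  free-base : Free (1 ∷ [])
  free-step : ∀ (rs : List ℕ) (r : ℕ) →
    rs ≢ [] →
    IsNumerical (rs ∷ʳ r) →
    IsMinimalGens (rs ∷ʳ r) →
    -- gluing of {r_0,…,r_{h-1}} and {r_h}: lcm(d_h, r_h) ∈ ⟨r_0,…,r_{h-1}⟩ ∩ ⟨r_h⟩
    lcm (gcdList rs) r ∈⟨ rs ⟩ →
    lcm (gcdList rs) r ∈⟨ r ∷ [] ⟩ →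
    Free (map (λ x → divBy x (gcdList rs)) rs) →
    Free (rs ∷ʳ r)

data Increasing : List ℕ → Set where
  inc-[]  : Increasing []
  inc-[-] : ∀ {x} → Increasing (x ∷ [])
  inc-∷   : ∀ {x y xs} → x < y → Increasing (y ∷ xs) → Increasing (x ∷ y ∷ xs)

-- Telescopic: free for the arrangement of minimal generators in increasing order
-- (gs is assumed to be the minimal generating set listed increasingly)
Telescopic : List ℕ → Set
Telescopic gs = Free gs

IsFrobenius : List ℕ → ℕ → Set
IsFrobenius X F = ¬ (F ∈⟨ X ⟩) × (∀ n → F < n → n ∈⟨ X ⟩)

module Submission where

open import Defs
open import Data.Nat using (ℕ; suc; _+_; _*_; _∸_; _^_; _≤_)
open import Data.List using (List; length)
open import Relation.Nullary using (¬_)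

open import Data.Nat using (zero; _<_; z≤n; s≤s; NonZero; ≢-nonZero)
open import Data.Nat.Properties
open import Data.Nat.Divisibility
open import Data.Nat.DivMod using (m*[n/m]≡n; m/n*n≡m; m<n*o⇒m/o<n)
open import Data.Nat.GCD using (gcd; gcd[m,n]∣m; gcd[m,n]∣n; gcd[m,n]≢0)
open import Data.Nat.LCM using (lcm; gcd*lcm)
open import Data.Nat.Coprimality using (Coprime; coprime-divisor; coprime⇒gcd≡1)
open import Data.Nat.Tactic.RingSolver using (solve-∀)
open import Data.List using ([]; _∷_; _∷ʳ_; map; removeAt; lookup)
open import Data.List.Properties using (length-map; length-++)
open import Data.List.Membership.Propositional using (_∈_)
open import Data.List.Membership.Propositional.Properties using (∈-map⁺; ∈-map⁻; ∈-++⁻; ∈-++⁺ʳ)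
open import Data.List.Relation.Unary.Any using (here)
open import Data.List.Relation.Unary.All as All using (All; []; _∷_)
import Data.List.Relation.Unary.All.Properties as All
open import Data.List.Relation.Unary.AllPairs using (AllPairs; []; _∷_)
open import Data.List.Relation.Unary.Linked using (Linked; []; [-]; _∷_)
open import Data.List.Relation.Unary.Linked.Properties using (Linked⇒AllPairs)
open import Data.Fin using (Fin)
open import Data.Product using (∃; ∃₂; _×_; _,_)
open import Data.Sum using (inj₁; inj₂)
open import Data.Empty using (⊥-elim)
open import Function using (_∘_)
open import Relation.Nullary using (yes; no)
open import Relation.Binary.PropositionalEquality

-- Write the arrangement as (rs, r) with d = gcd rs, so that ⟨rs, r⟩ is the gluing
-- of d·⟨rs/d⟩ and ⟨r⟩.  The gluing conditions force d ≥ 2, gcd(d, r) = 1 and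
-- r ∈ ⟨rs/d⟩, and then c(⟨rs, r⟩) = d·c(⟨rs/d⟩) + (d - 1)(r - 1).  In increasing
-- order r exceeds d times every generator of ⟨rs/d⟩, so by induction the largest
-- generator of a telescopic semigroup with e generators is at least 2^e - 1; feeding
-- d ≥ 2 and this bound on r into the conductor formula gives c ≥ (e - 2)·2^e + 2.

∈⟨⟩-+ : ∀ {X m n} → m ∈⟨ X ⟩ → n ∈⟨ X ⟩ → (m + n) ∈⟨ X ⟩
∈⟨⟩-+ zero∈ n∈ = n∈
∈⟨⟩-+ {X} {n = n} (add∈ {a = a} {n = m} a∈ m∈) n∈ =
  subst (_∈⟨ X ⟩) (sym (+-assoc a m n)) (add∈ a∈ (∈⟨⟩-+ m∈ n∈))

∈⟨⟩-* : ∀ {X r} → r ∈⟨ X ⟩ → ∀ k → (k * r) ∈⟨ X ⟩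
∈⟨⟩-* r∈ zero    = zero∈
∈⟨⟩-* r∈ (suc k) = ∈⟨⟩-+ r∈ (∈⟨⟩-* r∈ k)

∈⟨⟩-∣ : ∀ {X i n} → All (i ∣_) X → n ∈⟨ X ⟩ → i ∣ n
∈⟨⟩-∣ i∣X zero∈        = _ ∣0
∈⟨⟩-∣ i∣X (add∈ a∈ n∈) = ∣m∣n⇒∣m+n (All.lookup i∣X a∈) (∈⟨⟩-∣ i∣X n∈)

∈⟨∷ʳ⟩⁻ : ∀ {rs r n} → n ∈⟨ rs ∷ʳ r ⟩ → ∃₂ λ m k → m ∈⟨ rs ⟩ × n ≡ m + k * r
∈⟨∷ʳ⟩⁻ zero∈ = 0 , 0 , zero∈ , refl
∈⟨∷ʳ⟩⁻ {rs} {r} (add∈ {a = a} a∈ n∈) with ∈⟨∷ʳ⟩⁻ n∈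
... | m , k , m∈ , refl with ∈-++⁻ rs a∈
...   | inj₁ a∈rs        = a + m , k , add∈ a∈rs m∈ , sym (+-assoc a m (k * r))
...   | inj₂ (here refl) = m , suc k , m∈ , shift r m k
  where
  shift : ∀ r m k → r + (m + k * r) ≡ m + suc k * r
  shift = solve-∀

_÷_ : List ℕ → ℕ → List ℕ
rs ÷ d = map (λ x → divBy x d) rs

m*divBy[n,m]≡n : ∀ {m n} .{{_ : NonZero m}} → m ∣ n → m * divBy n m ≡ n
m*divBy[n,m]≡n {suc _} = m*[n/m]≡n

divBy-mono-< : ∀ {d x y} .{{_ : NonZero d}} → d ∣ y → x < y → divBy x d < divBy y d
divBy-mono-< {suc _} {x} d∣y x<y = m<n*o⇒m/o<n (subst (x <_) (sym (m/n*n≡m d∣y)) x<y)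

∈⟨⟩-÷ : ∀ {rs d m} .{{_ : NonZero d}} → All (d ∣_) rs → m ∈⟨ rs ⟩ →
  ∃ λ a → a ∈⟨ rs ÷ d ⟩ × m ≡ d * a
∈⟨⟩-÷ {d = d} _ zero∈ = 0 , zero∈ , sym (*-zeroʳ d)
∈⟨⟩-÷ {rs} {d} d∣rs (add∈ {a = x} x∈ m∈) with ∈⟨⟩-÷ d∣rs m∈
... | a , a∈ , refl = divBy x d + a , add∈ (∈-map⁺ _ x∈) a∈ , (begin
  x + d * a                  ≡⟨ cong (_+ d * a) (sym (m*divBy[n,m]≡n (All.lookup d∣rs x∈))) ⟩
  d * divBy x d + d * a      ≡⟨ sym (*-distribˡ-+ d (divBy x d) a) ⟩
  d * (divBy x d + a)        ∎)
  where open ≡-Reasoning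

*-∈⟨⟩⇒∈⟨÷⟩ : ∀ {rs d r} .{{_ : NonZero d}} → All (d ∣_) rs → (d * r) ∈⟨ rs ⟩ → r ∈⟨ rs ÷ d ⟩
*-∈⟨⟩⇒∈⟨÷⟩ {rs} {d} {r} d∣rs dr∈ with ∈⟨⟩-÷ d∣rs dr∈
... | a , a∈ , dr≡da = subst (_∈⟨ rs ÷ d ⟩) (sym (*-cancelˡ-≡ r a d dr≡da)) a∈

∈÷⇒*< : ∀ {rs d r y} .{{_ : NonZero d}} → All (d ∣_) rs → All (_< r) rs →
  y ∈ rs ÷ d → d * y < r
∈÷⇒*< {r = r} d∣rs rs<r y∈ with ∈-map⁻ _ y∈
... | x , x∈ , refl =
  subst (_< r) (sym (m*divBy[n,m]≡n (All.lookup d∣rs x∈))) (All.lookup rs<r x∈)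

allPairs-÷ : ∀ {rs d} .{{_ : NonZero d}} → All (d ∣_) rs → AllPairs _<_ rs → AllPairs _<_ (rs ÷ d)
allPairs-÷ []         []           = []
allPairs-÷ (_ ∷ d∣rs) (x<rs ∷ rs<) =
  All.map⁺ (All.zipWith (λ (x<y , d∣y) → divBy-mono-< d∣y x<y) (x<rs , d∣rs))
  ∷ allPairs-÷ d∣rs rs<

allPairs-∷ʳ⁻ : ∀ {rs r} → AllPairs _<_ (rs ∷ʳ r) → AllPairs _<_ rs × All (_< r) rs
allPairs-∷ʳ⁻ {[]}     _               = [] , []
allPairs-∷ʳ⁻ {x ∷ rs} (x<rs∷ʳr ∷ rs∷ʳr<) with allPairs-∷ʳ⁻ rs∷ʳr< | All.++⁻ rs x<rs∷ʳr
... | rs< , rs<r | x<rs , x<r ∷ [] = (x<rs ∷ rs<) , (x<r ∷ rs<r)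

increasing⇒linked : ∀ {xs} → Increasing xs → Linked _<_ xs
increasing⇒linked inc-[]         = []
increasing⇒linked inc-[-]        = [-]
increasing⇒linked (inc-∷ x<y inc) = x<y ∷ increasing⇒linked inc

gcdList-∣ : ∀ rs → All (gcdList rs ∣_) rs
gcdList-∣ []       = []
gcdList-∣ (x ∷ xs) = gcd[m,n]∣m x _ ∷ All.map (∣-trans (gcd[m,n]∣n x _)) (gcdList-∣ xs)

numerical⇒commonDivisor≡1 : ∀ {X i} → IsNumerical X → All (i ∣_) X → i ≡ 1
numerical⇒commonDivisor≡1 (N , cofinite) i∣X = ∣1⇒≡1 (∣m+n∣m⇒∣n
  (∈⟨⟩-∣ i∣X (cofinite (N + 1) (m≤m+n N 1)))
  (∈⟨⟩-∣ i∣X (cofinite N ≤-refl)))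

numerical-∷ʳ⇒coprime : ∀ rs {r} → IsNumerical (rs ∷ʳ r) → Coprime (gcdList rs) r
numerical-∷ʳ⇒coprime rs num (i∣d , i∣r) = numerical⇒commonDivisor≡1 num
  (All.++⁺ (All.map (∣-trans i∣d) (gcdList-∣ rs)) (i∣r ∷ []))

coprime⇒lcm≡* : ∀ {m n} → Coprime m n → lcm m n ≡ m * n
coprime⇒lcm≡* {m} {n} cop = begin
  lcm m n            ≡⟨ sym (*-identityˡ (lcm m n)) ⟩
  1 * lcm m n        ≡⟨ cong (_* lcm m n) (sym (coprime⇒gcd≡1 cop)) ⟩
  gcd m n * lcm m n  ≡⟨ gcd*lcm m n ⟩
  m * n              ∎
  where open ≡-Reasoning

minimalGens-head≢0 : ∀ {x xs} → IsMinimalGens (x ∷ xs) → x ≢ 0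
minimalGens-head≢0 minimal refl = minimal Fin.zero zero∈

∷ʳ-lastIndex : ∀ (rs : List ℕ) r → ∃ λ (i : Fin (length (rs ∷ʳ r))) →
  lookup (rs ∷ʳ r) i ≡ r × removeAt (rs ∷ʳ r) i ≡ rs
∷ʳ-lastIndex []       r = Fin.zero , refl , refl
∷ʳ-lastIndex (x ∷ rs) r with ∷ʳ-lastIndex rs r
... | i , lookup≡ , removeAt≡ = Fin.suc i , lookup≡ , cong (x ∷_) removeAt≡

minimalGens-∷ʳ⇒∉ : ∀ rs {r} → IsMinimalGens (rs ∷ʳ r) → ¬ r ∈⟨ rs ⟩
minimalGens-∷ʳ⇒∉ rs {r} minimal r∈ with ∷ʳ-lastIndex rs r
... | i , lookup≡ , removeAt≡ = minimal i (subst₂ _∈⟨_⟩ (sym lookup≡) (sym removeAt≡) r∈)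

PredGap : List ℕ → ℕ → Set
PredGap X t = ∀ {n} → n ∈⟨ X ⟩ → suc n ≢ t

predGap⇒≤conductor : ∀ {X t F} → IsFrobenius X F → PredGap X t → t ≤ suc F
predGap⇒≤conductor {t = zero}  _              _   = z≤n
predGap⇒≤conductor {t = suc n} {F} (_ , F<⇒∈) gap with n ≤? F
... | yes n≤F = s≤s n≤F
... | no  n≰F = ⊥-elim (gap (F<⇒∈ n (≰⇒> n≰F)) refl)

frobenius≥1 : ∀ {X F} → IsFrobenius X F → 1 ≤ F
frobenius≥1 {F = zero}  (0∉ , _) = ⊥-elim (0∉ zero∈)
frobenius≥1 {F = suc _} _        = s≤s z≤n

-- Write d = 1 + δ and r = 1 + ρ; the hypothesis says d·a + k·r is the predecessor
-- of d·t + (d - 1)(r - 1), which rearranges to d·(a + 1) + r·(k + 1) = d·(t + r).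
glued-predecessor : ∀ {δ ρ t a k} → Coprime (suc δ) (suc ρ) →
  suc (suc δ * a + k * suc ρ) ≡ suc δ * t + δ * ρ →
  ∃ λ j → suc (a + j * suc ρ) ≡ t
glued-predecessor {δ} {ρ} {t} {a} {k} cop eq = from-divisor (coprime-divisor cop d∣r*[1+k])
  where
  open ≡-Reasoning
  regroupˡ : ∀ δ ρ a k → suc δ * (a + 1) + suc ρ * suc k ≡ suc (suc δ * a + k * suc ρ) + δ + suc ρ
  regroupˡ = solve-∀
  regroupʳ : ∀ δ ρ t → suc δ * t + δ * ρ + δ + suc ρ ≡ suc δ * (t + suc ρ)
  regroupʳ = solve-∀
  expand : ∀ δ ρ a j → suc δ * (suc (a + j * suc ρ) + suc ρ) ≡ suc δ * (a + 1) + suc ρ * (suc j * suc δ)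
  expand = solve-∀
  rearranged : suc δ * (a + 1) + suc ρ * suc k ≡ suc δ * (t + suc ρ)
  rearranged = begin
    suc δ * (a + 1) + suc ρ * suc k      ≡⟨ regroupˡ δ ρ a k ⟩
    suc (suc δ * a + k * suc ρ) + δ + suc ρ ≡⟨ cong (λ z → z + δ + suc ρ) eq ⟩
    suc δ * t + δ * ρ + δ + suc ρ        ≡⟨ regroupʳ δ ρ t ⟩
    suc δ * (t + suc ρ)                  ∎
  d∣r*[1+k] : suc δ ∣ suc ρ * suc k
  d∣r*[1+k] = ∣m+n∣m⇒∣n (subst (suc δ ∣_) (sym rearranged) (m∣m*n (t + suc ρ))) (m∣m*n (a + 1))
  from-divisor : suc δ ∣ suc k → ∃ λ j → suc (a + j * suc ρ) ≡ t
  from-divisor (divides (suc j) 1+k≡) = j , +-cancelʳ-≡ (suc ρ) _ _ (*-cancelˡ-≡ _ _ (suc δ) (begin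
    suc δ * (suc (a + j * suc ρ) + suc ρ) ≡⟨ expand δ ρ a j ⟩
    suc δ * (a + 1) + suc ρ * (suc j * suc δ) ≡⟨ cong (λ z → suc δ * (a + 1) + suc ρ * z) (sym 1+k≡) ⟩
    suc δ * (a + 1) + suc ρ * suc k       ≡⟨ rearranged ⟩
    suc δ * (t + suc ρ)                   ∎))

predGap-∷ʳ : ∀ {rs d ρ t} .{{_ : NonZero d}} → All (d ∣_) rs → Coprime d (suc ρ) →
  suc ρ ∈⟨ rs ÷ d ⟩ → PredGap (rs ÷ d) t → PredGap (rs ∷ʳ suc ρ) (d * t + (d ∸ 1) * ρ)
predGap-∷ʳ {d = suc _} {t = t} d∣rs cop r∈ gap n∈ n+1≡ with ∈⟨∷ʳ⟩⁻ n∈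
... | m , k , m∈ , refl with ∈⟨⟩-÷ d∣rs m∈
... | a , a∈ , refl with glued-predecessor {t = t} {a} {k} cop n+1≡
... | j , a+jr+1≡t = gap (∈⟨⟩-+ a∈ (∈⟨⟩-* r∈ j)) a+jr+1≡t

2^[1+e]≤ : ∀ {e y d r} → 2 ^ e ≤ suc y → 2 ≤ d → d * y < r → 2 ^ suc e ≤ suc r
2^[1+e]≤ {e} {y} {d} {r} 2^e≤1+y 2≤d dy<r = begin
  2 * 2 ^ e   ≤⟨ *-monoʳ-≤ 2 2^e≤1+y ⟩
  2 * suc y   ≡⟨ *-suc 2 y ⟩
  2 + 2 * y   ≤⟨ +-monoʳ-≤ 2 (*-monoˡ-≤ y 2≤d) ⟩
  2 + d * y   ≤⟨ s≤s dy<r ⟩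
  suc r       ∎
  where open ≤-Reasoning

glued-conductor-≥ : ∀ {d t ρ} → 2 ≤ d → 2 * t + ρ ≤ d * t + (d ∸ 1) * ρ
glued-conductor-≥ {suc zero} (s≤s ())
glued-conductor-≥ {suc (suc δ)} {t} {ρ} 2≤d =
  +-mono-≤ (*-monoˡ-≤ t 2≤d) (m≤n*m ρ (suc δ))

conductor-bound-step : ∀ {e q t t′ ρ} → e * q + 2 ≤ t′ + 2 * q → 2 * q ≤ suc (suc ρ) →
  2 * t′ + ρ ≤ t → suc e * (2 * q) + 2 ≤ t + 2 * (2 * q)
conductor-bound-step {e} {q} {t} {t′} {ρ} bound′ 2q≤r+1 t≥ = +-cancelʳ-≤ 2 _ _ (begin
  suc e * (2 * q) + 2 + 2       ≡⟨ regroupˡ e q ⟩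
  2 * (e * q + 2) + 2 * q       ≤⟨ +-mono-≤ (*-monoʳ-≤ 2 bound′) 2q≤r+1 ⟩
  2 * (t′ + 2 * q) + suc (suc ρ) ≡⟨ regroupʳ q t′ ρ ⟩
  2 * t′ + ρ + 2 * (2 * q) + 2  ≤⟨ +-monoˡ-≤ 2 (+-monoˡ-≤ (2 * (2 * q)) t≥) ⟩
  t + 2 * (2 * q) + 2           ∎)
  where
  open ≤-Reasoning
  regroupˡ : ∀ e q → suc e * (2 * q) + 2 + 2 ≡ 2 * (e * q + 2) + 2 * q
  regroupˡ = solve-∀
  regroupʳ : ∀ q t′ ρ → 2 * (t′ + 2 * q) + suc (suc ρ) ≡ 2 * t′ + ρ + 2 * (2 * q) + 2
  regroupʳ = solve-∀

-- t is in fact the conductor, but only PredGap (which bounds it by the conductor) is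
-- carried along.  The bound on t is c ≥ (e - 2)·2^e + 2 with both sides shifted by
-- 2·2^e, avoiding truncated subtraction (for e = 1 the conductor is 0).
record FreeBounds (e : ℕ) (gs : List ℕ) : Set where
  field
    gen         : ℕ
    gen∈        : gen ∈ gs
    gen-large   : 2 ^ e ≤ suc gen
    t           : ℕ
    t-predGap   : PredGap gs t
    t-large     : e * 2 ^ e + 2 ≤ t + 2 * 2 ^ e

freeBounds-∷ʳ : ∀ {e rs d ρ} .{{_ : NonZero d}} → 2 ≤ d → All (d ∣_) rs →
  Coprime d (suc ρ) → suc ρ ∈⟨ rs ÷ d ⟩ → All (_< suc ρ) rs →
  FreeBounds e (rs ÷ d) → FreeBounds (suc e) (rs ∷ʳ suc ρ)
freeBounds-∷ʳ {e} {rs} {d} {ρ} 2≤d d∣rs cop r∈ rs<r bounds = record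
  { gen       = suc ρ
  ; gen∈      = ∈-++⁺ʳ rs (here refl)
  ; gen-large = r-large
  ; t         = d * t + (d ∸ 1) * ρ
  ; t-predGap = predGap-∷ʳ d∣rs cop r∈ t-predGap
  ; t-large   = conductor-bound-step {e} {2 ^ e} {t′ = t} t-large r-large (glued-conductor-≥ 2≤d)
  }
  where
  open FreeBounds bounds
  r-large : 2 ^ suc e ≤ suc (suc ρ)
  r-large = 2^[1+e]≤ {e} gen-large 2≤d (∈÷⇒*< d∣rs rs<r gen∈)

length-∷ʳ : ∀ (rs : List ℕ) r → length (rs ∷ʳ r) ≡ suc (length rs)
length-∷ʳ rs r = trans (length-++ rs) (+-comm (length rs) 1)

free⇒freeBounds : ∀ {gs} → Free gs → AllPairs _<_ gs → FreeBounds (length gs) gs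
free⇒freeBounds free-base _ = record
  { gen = 1 ; gen∈ = here refl ; gen-large = ≤-refl
  ; t = 0 ; t-predGap = λ _ () ; t-large = ≤-refl }
free⇒freeBounds (free-step [] _ []≢[] _ _ _ _ _) _ = ⊥-elim ([]≢[] refl)
free⇒freeBounds (free-step rs zero _ _ minimal _ _ _) _ = ⊥-elim (minimalGens-∷ʳ⇒∉ rs minimal zero∈)
free⇒freeBounds (free-step rs@(x ∷ xs) (suc ρ) _ num minimal lcm∈ _ free) ordered
  with allPairs-∷ʳ⁻ ordered
... | rs-ordered , rs<r =
  subst (λ e → FreeBounds e (rs ∷ʳ suc ρ)) (sym (length-∷ʳ rs (suc ρ)))
    (freeBounds-∷ʳ 2≤d d∣rs cop r∈ rs<r
      (subst (λ e → FreeBounds e (rs ÷ d)) (length-map _ rs)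
        (free⇒freeBounds free (allPairs-÷ d∣rs rs-ordered))))
  where
  d = gcdList rs
  d∣rs = gcdList-∣ rs
  d≢0 : d ≢ 0
  d≢0 = gcd[m,n]≢0 x _ (inj₁ (minimalGens-head≢0 minimal))
  instance
    d-nonZero : NonZero d
    d-nonZero = ≢-nonZero d≢0
  cop = numerical-∷ʳ⇒coprime rs num
  dr∈ : (d * suc ρ) ∈⟨ rs ⟩
  dr∈ = subst (_∈⟨ rs ⟩) (coprime⇒lcm≡* cop) lcm∈
  r∈ = *-∈⟨⟩⇒∈⟨÷⟩ d∣rs dr∈
  d≢1 : d ≢ 1
  d≢1 d≡1 = minimalGens-∷ʳ⇒∉ rs minimal
    (subst (_∈⟨ rs ⟩) (trans (cong (_* suc ρ) d≡1) (*-identityˡ (suc ρ))) dr∈)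
  2≤d : 2 ≤ d
  2≤d = ≤∧≢⇒< (n≢0⇒n>0 d≢0) (d≢1 ∘ sym)

conductor-≥ : ∀ {e t c} → 2 ≤ c → t ≤ c → e * 2 ^ e + 2 ≤ t + 2 * 2 ^ e →
  (e ∸ 2) * 2 ^ e + 2 ≤ c
conductor-≥ {zero}        2≤c _ _ = 2≤c
conductor-≥ {suc zero}    2≤c _ _ = 2≤c
conductor-≥ {suc (suc k)} {t} _ t≤c bound = ≤-trans (+-cancelʳ-≤ (2 * q) _ _
  (subst (_≤ t + 2 * q) (regroup k q) bound)) t≤c
  where
  q = 2 ^ suc (suc k)
  regroup : ∀ k q → suc (suc k) * q + 2 ≡ k * q + 2 + 2 * q
  regroup = solve-∀

proposition4p2 : (gs : List ℕ) → IsNumerical gs → IsMinimalGens gs → Increasing gs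
    → Telescopic gs → ¬ (∀ n → n ∈⟨ gs ⟩)
    → (F : ℕ) → IsFrobenius gs F
    → (length gs ∸ 2) * 2 ^ length gs + 2 ≤ suc F
proposition4p2 gs _ _ increasing telescopic _ F frobenius =
  conductor-≥ {length gs} (s≤s (frobenius≥1 frobenius)) (predGap⇒≤conductor frobenius t-predGap) t-large
  where
  open FreeBounds (free⇒freeBounds telescopic (Linked⇒AllPairs <-trans (increasing⇒linked increasing)))
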